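{- Let $G$ be a connected graph of order $n\ge 2$ with vertices $u_1,\dots,u_n$, and let $H_1,\dots,H_n$ be connected bipartite graphs, each $H_i$ with a chosen root vertex $v_i$. Then the rooted product graph $G\circ\mathcal{H}$ satisfies $\dim_l(G\circ\mathcal{H})=\dim_l(G)$.
   Context: The rooted product graph $G\circ\mathcal{H}$, for $\mathcal{H}=(H_1,\dots,H_n)$, is obtained from disjoint copies of $G,H_1,\dots,H_n$ by identifying the root $v_i$ of $H_i$ with the $i$-th vertex $u_i$ of $G$, for each $i$. For a connected graph $G$, a set $W\subseteq V(G)$ is a local metric generator if for every pair of adjacent vertices $u,v$ there is $w\in W$ with $d_G(u,w)\neq d_G(v,w)$ ($d_G$ the shortest-path distance); $\dim_l(G)$ is the minimum cardinality of a local metric generator. -}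

module Defs where

open import Level using (0ℓ)
open import Data.Nat using (ℕ; zero; suc; _≤_)
open import Data.Fin using (Fin)
open import Data.Bool using (Bool)
open import Data.Product using (Σ; ∃; ∃-syntax; _×_; _,_)
open import Data.Sum using (_⊎_)
open import Data.List using (List; length)
open import Data.List.Membership.Propositional using (_∈_)
open import Data.List.Relation.Unary.Unique.Propositional using (Unique)
open import Relation.Binary.PropositionalEquality using (_≡_; _≢_)
open import Relation.Nullary using (¬_)

record Graph (V : Set) : Set₁ where
  field
    Adj   : V → V → Set
    sym   : ∀ {u v} → Adj u v → Adj v u
    irrefl : ∀ {u} → ¬ Adj u u
open Graph public

data Walk {V : Set} (G : Graph V) : V → V → ℕ → Set where
  here : ∀ {u} → Walk G u u 0
  step : ∀ {u v w k} → Adj G u v → Walk G v w k → Walk G u w (suc k)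

Connected : {V : Set} → Graph V → Set
Connected G = ∀ u v → ∃[ k ] Walk G u v k

Dist : {V : Set} → Graph V → V → V → ℕ → Set
Dist G u v k = Walk G u v k × (∀ j → Walk G u v j → k ≤ j)

Bipartite : {V : Set} → Graph V → Set
Bipartite {V} G = Σ (V → Bool) λ c → ∀ {u v} → Adj G u v → c u ≢ c v

Distinguishes : {V : Set} → Graph V → V → V → V → Set
Distinguishes G w u v = ∀ k k′ → Dist G u w k → Dist G v w k′ → k ≢ k′

IsLocalMetricGenerator : {V : Set} → Graph V → List V → Set
IsLocalMetricGenerator G W =
  ∀ u v → Adj G u v → ∃[ w ] (w ∈ W × Distinguishes G w u v)

IsLocalMetricDim : {V : Set} → Graph V → ℕ → Set
IsLocalMetricDim G k =
  (∃[ W ] (Unique W × IsLocalMetricGenerator G W × length W ≡ k))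
  × (∀ W → Unique W → IsLocalMetricGenerator G W → k ≤ length W)

-- Rooted product G ∘ H: vertex (i , x) is vertex x of the copy of H i;
-- the root (i , root i) is identified with the i-th vertex of G.
RootedProduct : {n : ℕ} (G : Graph (Fin n)) (m : Fin n → ℕ)
  (H : (i : Fin n) → Graph (Fin (m i))) (root : (i : Fin n) → Fin (m i)) →
  Graph (Σ (Fin n) (λ i → Fin (m i)))
RootedProduct {n} G m H root = record { Adj = A ; sym = s ; irrefl = ir }
  where
  A : Σ (Fin n) (λ i → Fin (m i)) → Σ (Fin n) (λ i → Fin (m i)) → Set
  A (i , x) (j , y) =
    (Σ (i ≡ j) λ { _≡_.refl → Adj (H i) x y })
    ⊎ ((x ≡ root i) × (y ≡ root j) × Adj G i j)
  s : ∀ {u v} → A u v → A v u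
  s {i , x} {.i , y} (Data.Sum.inj₁ (_≡_.refl , a)) = Data.Sum.inj₁ (_≡_.refl , Graph.sym (H i) a)
  s (Data.Sum.inj₂ (p , q , a)) = Data.Sum.inj₂ (q , p , Graph.sym G a)
  ir : ∀ {u} → ¬ A u u
  ir {i , x} (Data.Sum.inj₁ (_≡_.refl , a)) = Graph.irrefl (H i) a
  ir (Data.Sum.inj₂ (_ , _ , a)) = Graph.irrefl G a

module Submission where

-- Write P = G ∘ H and base i = (i , root i) for the vertex of P glued to
-- vertex i of G.  The proof compares generators of G and of P in both
-- directions and concludes with a general "mutual reduction" principle:
--   * G → P.  If W generates G then base[W] generates P.  An edge of G is an
--     edge between bases, and distances between bases in P equal those in G.
--     An edge x y inside a copy H i is distinguished by EVERY vertex t of P: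
--     if t is in the same copy, a shortest walk from x or y to t stays in H i
--     and bipartiteness forbids equal lengths; otherwise both shortest walks
--     leave the copy through root i, so equal distances would give equally
--     long walks x → root i and y → root i in H i, again impossible.
--   * P → G.  If W generates P then its set of G-coordinates generates G,
--     because d_P(base i , (l , z)) = d_G(i , l) + d_{H l}(root l , z).
-- Neither map lengthens a generator, so the dimensions agree.

open import Defs
open import Data.Nat using (ℕ; zero; suc; _≤_; _<_; _+_; z≤n; s≤s)
open import Data.Nat.Properties
  using (+-comm; ≤-trans; ≤-reflexive; ≤-antisym; _≤?_; ≰⇒>; m≤n⇒m≤1+n;
         +-mono-≤; +-cancelˡ-≤; +-cancelʳ-≡)
open import Data.Nat.Induction using (<-rec)
open import Data.Fin using (Fin; zero; suc)
open import Data.Fin.Properties using (_≟_)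
open import Data.Bool using (Bool; not)
open import Data.Bool.Properties using (not-injective; ¬-not)
open import Data.Product using (Σ; ∃-syntax; _×_; _,_; proj₁; proj₂)
open import Data.Sum using (inj₁; inj₂)
open import Data.Empty using (⊥; ⊥-elim)
open import Data.List using (List; []; _∷_; length; map; deduplicate)
open import Data.List.Properties using (length-map; length-filter)
open import Data.List.Membership.Propositional using (_∈_)
open import Data.List.Membership.Propositional.Properties
  using (∈-map⁺; ∈-deduplicate⁺)
open import Data.List.Relation.Unary.Unique.Propositional using (Unique)
open import Data.List.Relation.Unary.Unique.Propositional.Properties using (map⁺)
open import Data.List.Relation.Unary.Unique.DecPropositional.Properties using (deduplicate-!)
open import Function using (_∘_)
open import Function.Bundles using (_⇔_; mk⇔)
open import Relation.Binary.Definitions using (DecidableEquality)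
open import Relation.Binary.PropositionalEquality
  using (_≡_; refl; trans; cong; subst; subst₂; ≢-sym; module ≡-Reasoning)
  renaming (sym to ≡-sym)
open import Relation.Nullary using (¬_; yes; no; ¬?)

module _ {V : Set} {G : Graph V} where

  _++ʷ_ : ∀ {u v w a b} → Walk G u v a → Walk G v w b → Walk G u w (a + b)
  here ++ʷ q = q
  step e p ++ʷ q = step e (p ++ʷ q)

  reverseʷ : ∀ {u v a} → Walk G u v a → Walk G v u a
  reverseʷ here = here
  reverseʷ {a = suc a} (step e p) =
    subst (Walk G _ _) (+-comm a 1) (reverseʷ p ++ʷ step (Graph.sym G e) here)

  -- Constructively this
  -- only yields the distance under double negation, which is enough for
  -- the negative goals (Distinguishes) where distances are needed.
  dist-¬¬ : ∀ {u v k} → Walk G u v k → ¬ ¬ (∃[ d ] Dist G u v d)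
  dist-¬¬ {u} {v} {k} = <-rec (λ k → Walk G u v k → ¬ ¬ (∃[ d ] Dist G u v d)) go k
    where
    go : ∀ k → (∀ {j} → j < k → Walk G u v j → ¬ ¬ (∃[ d ] Dist G u v d)) →
         Walk G u v k → ¬ ¬ (∃[ d ] Dist G u v d)
    go k shorter w noDist = noDist (k , w , minimal)
      where
      minimal : ∀ j → Walk G u v j → k ≤ j
      minimal j wj with k ≤? j
      ... | yes k≤j = k≤j
      ... | no k≰j = ⊥-elim (shorter (≰⇒> k≰j) wj noDist)

Dist-transfer : {V U : Set} {A : Graph V} {B : Graph U} {x y : V} {x′ y′ : U} →
  (∀ {d} → Walk A x y d → ∃[ e ] (e ≤ d × Walk B x′ y′ e)) →
  (∀ {e} → Walk B x′ y′ e → Walk A x y e) →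
  ∀ {d} → Dist A x y d → Dist B x′ y′ d
Dist-transfer {B = B} {x′ = x′} {y′} shorten lift (w , minimal) =
  let (e , e≤d , w′) = shorten w in
  subst (Walk B x′ y′) (≤-antisym e≤d (minimal e (lift w′))) w′ ,
  λ j wj → minimal j (lift wj)

notⁿ : ℕ → Bool → Bool
notⁿ zero b = b
notⁿ (suc k) b = notⁿ k (not b)

notⁿ-injective : ∀ k {a b} → notⁿ k a ≡ notⁿ k b → a ≡ b
notⁿ-injective zero eq = eq
notⁿ-injective (suc k) eq = not-injective (notⁿ-injective k eq)

colour-along : {V : Set} {H : Graph V} (B : Bipartite H) →
  ∀ {x z k} → Walk H x z k → proj₁ B z ≡ notⁿ k (proj₁ B x)
colour-along B here = refl
colour-along B (step {k = k} e p) =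
  trans (colour-along B p) (cong (notⁿ k) (¬-not (≢-sym (proj₂ B e))))

-- In a bipartite graph, adjacent vertices have no equally long walks to a
-- common vertex; this is what makes every vertex distinguish them.
bipartite-parity : {V : Set} {H : Graph V} → Bipartite H →
  ∀ {x y z k} → Adj H x y → Walk H x z k → Walk H y z k → ⊥
bipartite-parity B {k = k} e p q =
  proj₂ B e (notⁿ-injective k (trans (≡-sym (colour-along B p)) (colour-along B q)))

length-deduplicate : {A : Set} (_≟ᴬ_ : DecidableEquality A) →
  ∀ xs → length (deduplicate _≟ᴬ_ xs) ≤ length xs
length-deduplicate _≟ᴬ_ [] = z≤n
length-deduplicate _≟ᴬ_ (x ∷ xs) =
  s≤s (≤-trans (length-filter (¬? ∘ (x ≟ᴬ_)) (deduplicate _≟ᴬ_ xs))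
               (length-deduplicate _≟ᴬ_ xs))

generator-⊆ : {V : Set} (G : Graph V) {W W′ : List V} →
  (∀ {w} → w ∈ W → w ∈ W′) →
  IsLocalMetricGenerator G W → IsLocalMetricGenerator G W′
generator-⊆ G W⊆W′ gen u v e =
  let (w , w∈W , distinguishes) = gen u v e in w , W⊆W′ w∈W , distinguishes

GeneratorReduction : {V U : Set} → Graph V → Graph U → Set
GeneratorReduction G G′ = ∀ W → Unique W → IsLocalMetricGenerator G W →
  ∃[ W′ ] (Unique W′ × IsLocalMetricGenerator G′ W′ × length W′ ≤ length W)

dim-from-reductions : {V U : Set} {G : Graph V} {G′ : Graph U} →
  GeneratorReduction G G′ → GeneratorReduction G′ G →
  ∀ k → IsLocalMetricDim G k → IsLocalMetricDim G′ k
dim-from-reductions to from k ((W , uniq , gen , len≡k) , minimal) =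
  let (W′ , uniq′ , gen′ , shorter) = to W uniq gen in
  (W′ , uniq′ , gen′ ,
     ≤-antisym (subst (length W′ ≤_) len≡k shorter) (lower-bound W′ uniq′ gen′)) ,
  lower-bound
  where
  lower-bound : ∀ W′ → Unique W′ → IsLocalMetricGenerator _ W′ → k ≤ length W′
  lower-bound W′ uniq′ gen′ =
    let (W″ , uniq″ , gen″ , shorter) = from W′ uniq′ gen′ in
    ≤-trans (minimal W″ uniq″ gen″) shorter

dim-⇔ : {V U : Set} {G : Graph V} {G′ : Graph U} →
  GeneratorReduction G G′ → GeneratorReduction G′ G →
  ∀ k → IsLocalMetricDim G k ⇔ IsLocalMetricDim G′ k
dim-⇔ to from k = mk⇔ (dim-from-reductions to from k) (dim-from-reductions from to k)

module RootedProductGeometry {n : ℕ} (G : Graph (Fin n)) (m : Fin n → ℕ)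
  (H : (i : Fin n) → Graph (Fin (m i))) (root : (i : Fin n) → Fin (m i)) where

  Vertex : Set
  Vertex = Σ (Fin n) (λ i → Fin (m i))

  P : Graph Vertex
  P = RootedProduct G m H root

  base : Fin n → Vertex
  base i = i , root i

  copyWalk : ∀ {i x z e} → Walk (H i) x z e → Walk P (i , x) (i , z) e
  copyWalk here = here
  copyWalk (step a p) = step (inj₁ (refl , a)) (copyWalk p)

  baseWalk : ∀ {i j e} → Walk G i j e → Walk P (base i) (base j) e
  baseWalk here = here
  baseWalk (step a p) = step (inj₂ (refl , refl , a)) (baseWalk p)

  project : ∀ {u v d} → Walk P u v d → ∃[ e ] (e ≤ d × Walk G (proj₁ u) (proj₁ v) e)
  project here = 0 , z≤n , here
  project (step (inj₁ (refl , _)) p) =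
    let (e , e≤d , w) = project p in e , m≤n⇒m≤1+n e≤d , w
  project (step (inj₂ (_ , _ , a)) p) =
    let (e , e≤d , w) = project p in suc e , s≤s e≤d , step a w

  retract : (i : Fin n) → Vertex → Fin (m i)
  retract i (j , y) with j ≟ i
  ... | yes refl = y
  ... | no _ = root i

  retract-copy : ∀ i y → retract i (i , y) ≡ y
  retract-copy i y with i ≟ i
  ... | yes refl = refl
  ... | no i≢i = ⊥-elim (i≢i refl)

  retract-base : ∀ i j → retract i (base j) ≡ root i
  retract-base i j with j ≟ i
  ... | yes refl = refl
  ... | no _ = refl

  retractStep : ∀ i {u v} → Adj P u v →
    ∃[ e ] (e ≤ 1 × Walk (H i) (retract i u) (retract i v) e)
  retractStep i {j , _} (inj₁ (refl , a)) with j ≟ i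
  ... | yes refl = 1 , s≤s z≤n , step a here
  ... | no _ = 0 , z≤n , here
  retractStep i {j , _} {j′ , _} (inj₂ (refl , refl , _)) =
    0 , z≤n , subst (λ r → Walk (H i) (retract i (base j)) r 0)
                    (trans (retract-base i j) (≡-sym (retract-base i j′))) here

  retractWalk : ∀ i {u v d} → Walk P u v d →
    ∃[ e ] (e ≤ d × Walk (H i) (retract i u) (retract i v) e)
  retractWalk i here = 0 , z≤n , here
  retractWalk i (step a p) =
    let (e₁ , e₁≤1 , w₁) = retractStep i a
        (e₂ , e₂≤d , w₂) = retractWalk i p in
    e₁ + e₂ , +-mono-≤ e₁≤1 e₂≤d , w₁ ++ʷ w₂

  retractWalk-copy : ∀ {i x z d} → Walk P (i , x) (i , z) d →
    ∃[ e ] (e ≤ d × Walk (H i) x z e)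
  retractWalk-copy {i} {x} {z} w =
    let (e , e≤d , w′) = retractWalk i w in
    e , e≤d , subst₂ (λ p q → Walk (H i) p q e) (retract-copy i x) (retract-copy i z) w′

  dist-base : ∀ {i l d} → Dist P (base i) (base l) d → Dist G i l d
  dist-base = Dist-transfer project baseWalk

  dist-copy : ∀ {i x z d} → Dist P (i , x) (i , z) d → Dist (H i) x z d
  dist-copy = Dist-transfer retractWalk-copy copyWalk

  OffCopy : Fin n → Vertex → Set
  OffCopy l t = ∀ y → t ≡ (l , y) → y ≡ root l

  base-off-copy : ∀ i l → OffCopy l (base i)
  base-off-copy i l y refl = refl

  exit-through-root : ∀ {l z t d} → Walk P (l , z) t d → OffCopy l t →
    ∃[ h ] ∃[ e ] (Walk (H l) z (root l) h × Walk P (base l) t e × h + e ≡ d)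
  exit-through-root {l} {z} here off with off z refl
  ... | refl = 0 , 0 , here , here , refl
  exit-through-root (step (inj₁ (refl , a)) p) off =
    let (h , e , p₁ , p₂ , h+e≡d) = exit-through-root p off in
    suc h , e , step a p₁ , p₂ , cong suc h+e≡d
  exit-through-root {d = d} (step (inj₂ (refl , q , a)) p) _ =
    0 , d , here , step (inj₂ (refl , q , a)) p , refl

  dist-through-root : ∀ {i l z k h d} → Dist G i l k → Dist (H l) (root l) z h →
    Dist P (base i) (l , z) d → d ≡ k + h
  dist-through-root {i} {l} {k = k} {h} {d} (wG , minG) (wH , minH) (wP , minP) =
    ≤-antisym (minP (k + h) (baseWalk wG ++ʷ copyWalk wH)) k+h≤d
    where
    k+h≤d : k + h ≤ d
    k+h≤d =
      let (h′ , e , toRoot , fromBase , h′+e≡d) =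
            exit-through-root (reverseʷ wP) (base-off-copy i l)
          (e′ , e′≤e , wG′) = project fromBase in
      subst (k + h ≤_) (trans (+-comm e h′) h′+e≡d)
        (+-mono-≤ (≤-trans (minG e′ (reverseʷ wG′)) e′≤e) (minH h′ (reverseʷ toRoot)))

  module _ (bipartite : ∀ i → Bipartite (H i)) where

    -- An edge x y of copy i is distinguished by every vertex off that copy:
    -- equal distances would force equally long walks x → root i and
    -- y → root i in H i.
    off-copy-distinguishes : ∀ {i x y t} → Adj (H i) x y → OffCopy i t →
      Distinguishes P t (i , x) (i , y)
    off-copy-distinguishes {i} {y = y} a off d d′ (wx , minx) (wy , miny) d≡d′
      with exit-through-root wx off | exit-through-root wy off
    ... | h , e , px , qx , h+e≡d | h′ , e′ , py , qy , h′+e′≡d′ =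
      bipartite-parity (bipartite i) a px (subst (Walk (H i) y (root i)) (≡-sym h≡h′) py)
      where
      open ≡-Reasoning

      -- Each start may use the other's exit path, so the exit paths agree.
      e≤e′ : e ≤ e′
      e≤e′ = +-cancelˡ-≤ h e e′ (subst (_≤ h + e′) (≡-sym h+e≡d) (minx _ (copyWalk px ++ʷ qy)))
      e′≤e : e′ ≤ e
      e′≤e = +-cancelˡ-≤ h′ e′ e (subst (_≤ h′ + e) (≡-sym h′+e′≡d′) (miny _ (copyWalk py ++ʷ qx)))

      h≡h′ : h ≡ h′
      h≡h′ = +-cancelʳ-≡ e h h′ (begin
        h + e    ≡⟨ h+e≡d ⟩
        d        ≡⟨ d≡d′ ⟩
        d′       ≡⟨ ≡-sym h′+e′≡d′ ⟩
        h′ + e′  ≡⟨ cong (h′ +_) (≤-antisym e′≤e e≤e′) ⟩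
        h′ + e   ∎)

    copy-edge-distinguished : ∀ {i x y} → Adj (H i) x y →
      ∀ t → Distinguishes P t (i , x) (i , y)
    copy-edge-distinguished {i} {y = y} a (l , z) d d′ D D′ d≡d′ with l ≟ i
    ... | yes refl =
      bipartite-parity (bipartite i) a (proj₁ (dist-copy D))
        (subst (Walk (H i) y z) (≡-sym d≡d′) (proj₁ (dist-copy D′)))
    ... | no l≢i =
      off-copy-distinguishes a (λ _ eq → ⊥-elim (l≢i (cong proj₁ eq))) d d′ D D′ d≡d′

    -- The bases over a generator of G generate P (G must have an edge so
    -- that the generator is nonempty, to serve the edges of the copies).
    embed-generator : (∃[ a ] ∃[ b ] Adj G a b) →
      ∀ W → IsLocalMetricGenerator G W → IsLocalMetricGenerator P (map base W)
    embed-generator (a , b , ab) W gen (i , _) (.i , _) (inj₁ (refl , xy)) =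
      let (w , w∈W , _) = gen a b ab in
      base w , ∈-map⁺ base w∈W , copy-edge-distinguished xy (base w)
    embed-generator _ W gen (i , _) (j , _) (inj₂ (refl , refl , ij)) =
      let (w , w∈W , distinguishes) = gen i j ij in
      base w , ∈-map⁺ base w∈W ,
      λ k k′ D D′ → distinguishes k k′ (dist-base D) (dist-base D′)

  project-generator : (∀ i → Connected (H i)) →
    ∀ W → IsLocalMetricGenerator P W → IsLocalMetricGenerator G (map proj₁ W)
  project-generator connected W gen i j ij =
    let ((l , z) , t∈W , distinguishes) = gen (base i) (base j) (inj₂ (refl , refl , ij)) in
    l , ∈-map⁺ proj₁ t∈W , λ k k′ Dk Dk′ k≡k′ →
      let (_ , root→z) = connected l (root l) z in
      dist-¬¬ root→z λ (h , Dh) →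
      dist-¬¬ (baseWalk (proj₁ Dk) ++ʷ copyWalk root→z) λ (d , D) →
      dist-¬¬ (baseWalk (proj₁ Dk′) ++ʷ copyWalk root→z) λ (d′ , D′) →
      distinguishes d d′ D D′ (begin
        d       ≡⟨ dist-through-root Dk Dh D ⟩
        k + h   ≡⟨ cong (_+ h) k≡k′ ⟩
        k′ + h  ≡⟨ ≡-sym (dist-through-root Dk′ Dh D′) ⟩
        d′      ∎)
    where open ≡-Reasoning

has-edge : ∀ {n} → 2 ≤ n → (G : Graph (Fin n)) → Connected G → ∃[ a ] ∃[ b ] Adj G a b
has-edge (s≤s (s≤s _)) G connected with connected zero (suc zero)
... | _ , step e _ = _ , _ , e

corollary7 : (n : ℕ) → 2 ≤ n → (G : Graph (Fin n)) → Connected G →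
    (m : Fin n → ℕ) → (H : (i : Fin n) → Graph (Fin (m i))) →
    (root : (i : Fin n) → Fin (m i)) →
    (∀ i → Connected (H i)) → (∀ i → Bipartite (H i)) →
    ∀ k → IsLocalMetricDim (RootedProduct G m H root) k ⇔ IsLocalMetricDim G k
corollary7 _ 2≤n G connected m H root connectedH bipartite =
  dim-⇔ product→base base→product
  where
  open RootedProductGeometry G m H root

  product→base : GeneratorReduction P G
  product→base W _ gen =
    deduplicate _≟_ (map proj₁ W) ,
    deduplicate-! _≟_ (map proj₁ W) ,
    generator-⊆ G (∈-deduplicate⁺ _≟_) (project-generator connectedH W gen) ,
    ≤-trans (length-deduplicate _≟_ (map proj₁ W)) (≤-reflexive (length-map proj₁ W))

  base→product : GeneratorReduction G P
  base→product W uniq gen =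
    map base W , map⁺ (cong proj₁) uniq ,
    embed-generator bipartite (has-edge 2≤n G connected) W gen ,
    ≤-reflexive (length-map base W)
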